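{- Let $X$ be a finite set and let $\mathcal{F}\subseteq\mathcal{M}_X$ be a downset of the multiset poset $\mathcal{M}_X$. Then $\dim \mathcal{F} = \dim s(\mathcal{F})$, where $s(\mathcal{F})$ is ordered by inclusion.
   Context: $\mathcal{M}_X$ is the poset of finite multisets with elements in $X$, ordered by containment with multiplicity: writing $\nu_x(A)$ for the multiplicity of $x$ in $A$, $A\le B$ iff $\nu_x(A)\le\nu_x(B)$ for all $x\in X$. The support of $A\in\mathcal{M}_X$ is $s(A)=\{x\in X:\nu_x(A)>0\}$, and for $\mathcal{A}\subseteq\mathcal{M}_X$, $s(\mathcal{A})=\{s(A):A\in\mathcal{A}\}$. A downset of a poset $P$ is a subset $F$ such that $b\in F$ and $a\le_P b$ imply $a\in F$, with the induced order. For a poset $P=(S,\le_P)$, a realiser is a set $\mathcal{L}$ of linear extensions of $P$ such that for every $(a,b)\in S^2$ with $a\not\ge_P b$ some $L\in\mathcal{L}$ has $a\le_L b$; $\dim P$ is the minimum cardinality of a realiser. -}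

module Defs where

open import Data.Nat using (ℕ; zero; suc; _≤_)
open import Data.Fin using (Fin)
open import Data.Fin.Subset using (Subset; _⊆_; inside; outside)
open import Data.Vec using (tabulate)
open import Data.Product using (Σ; ∃; _×_; _,_)
open import Data.Sum using (_⊎_)
open import Relation.Nullary using (¬_)
open import Relation.Binary.PropositionalEquality using (_≡_)

-- A poset presented as a subset `elem` of a carrier type, together with
-- an order relation `_≤P_` and the equality `_≈P_` used for antisymmetry.
record SubPoset : Set₁ where
  field
    Carrier : Set
    elem    : Carrier → Set
    _≈P_    : Carrier → Carrier → Set
    _≤P_    : Carrier → Carrier → Set

record IsLinearExtension (P : SubPoset) (L : SubPoset.Carrier P → SubPoset.Carrier P → Set) : Set where
  open SubPoset P
  field
    reflexive  : ∀ a → elem a → L a a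
    antisym    : ∀ a b → elem a → elem b → L a b → L b a → a ≈P b
    trans      : ∀ a b c → elem a → elem b → elem c → L a b → L b c → L a c
    total      : ∀ a b → elem a → elem b → L a b ⊎ L b a
    extends    : ∀ a b → elem a → elem b → a ≤P b → L a b

-- A realiser of P consisting of (at most) k linear extensions, given as a
-- family indexed by Fin k: for every pair (a, b) with a ≱ b some L has a ≤_L b.
record Realiser (P : SubPoset) (k : ℕ) : Set₁ where
  open SubPoset P
  field
    ext       : Fin k → Carrier → Carrier → Set
    isLinExt  : ∀ i → IsLinearExtension P (ext i)
    realises  : ∀ a b → elem a → elem b → ¬ (b ≤P a) → ∃ λ i → ext i a b

DimAtMost : SubPoset → ℕ → Set₁
DimAtMost P k = Realiser P k

Multiset : ℕ → Set
Multiset n = Fin n → ℕ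

_≤M_ : ∀ {n} → Multiset n → Multiset n → Set
A ≤M B = ∀ x → A x ≤ B x

_≈M_ : ∀ {n} → Multiset n → Multiset n → Set
A ≈M B = ∀ x → A x ≡ B x

IsDownset : ∀ {n} → (Multiset n → Set) → Set
IsDownset F = ∀ A B → F B → A ≤M B → F A

support : ∀ {n} → Multiset n → Subset n
support A = tabulate λ x → supp (A x)
  where
  supp : ℕ → _
  supp zero    = outside
  supp (suc _) = inside

MultisetPoset : ∀ n → (Multiset n → Set) → SubPoset
MultisetPoset n F = record
  { Carrier = Multiset n ; elem = F ; _≈P_ = _≈M_ ; _≤P_ = _≤M_ }

SupportPoset : ∀ n → (Multiset n → Set) → SubPoset
SupportPoset n F = record
  { Carrier = Subset n
  ; elem    = λ S → Σ (Multiset n) λ A → F A × support A ≡ S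
  ; _≈P_    = _≡_
  ; _≤P_    = _⊆_ }

-- Sending a set to its indicator multiset embeds s(F) into F as an induced subposet
-- (F is a downset), so dim s(F) ≤ dim F. Conversely, a linear extension L of s(F)
-- linearly orders the points x with {x} ∈ s(F), and two multisets of F differ only at
-- such points; comparing them where they differ at the L-largest point is a linear
-- extension of F. If B ≰ A, say A x < B x, an extension L placing s(A) ∖ {x} below {x}
-- ranks every point where A exceeds B below x, so its lexicographic order puts A below B.
module Submission where

open import Defs
open import Data.Nat using (ℕ; zero; suc; _<_; _≤_; z≤n; s≤s; _≤?_; _≟_)
open import Data.Nat.Properties
  using (≤-reflexive; <⇒≤; <⇒≢; >⇒≢; ≤∧≢⇒<; ≰⇒>; <-asym; <-cmp; ≤-<-trans; <-≤-trans)
open import Data.Bool using (true; false; if_then_else_)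
open import Data.Fin using (Fin)
open import Data.Fin.Properties using (¬∀⟶∃¬)
open import Data.Fin.Subset using (Subset; _⊆_; _∈_; ⁅_⁆; _∩_; ∁; inside)
open import Data.Fin.Subset.Properties
  using (⊆-refl; ⊆-reflexive; ⊆-antisym; x∈⁅x⁆; x∈⁅y⁆⇒x≡y; x≢y⇒x∉⁅y⁆; p∩q⊆p; x∈p∩q⁺; x∈p∩q⁻; x∈∁p⇒x∉p; x∉p⇒x∈∁p)
open import Data.Vec using (lookup)
open import Data.Vec.Properties using (lookup∘tabulate; []=⇒lookup; lookup⇒[]=)
open import Data.List using ([]; _∷_; allFin)
open import Data.List.Relation.Unary.Any using (here; there)
open import Data.List.Membership.Propositional using () renaming (_∈_ to _∈ˡ_)
open import Data.List.Membership.Propositional.Properties using (∈-allFin)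
open import Data.Product using (∃; _×_; _,_; proj₁; proj₂)
open import Data.Sum using (_⊎_; inj₁; inj₂)
open import Data.Empty using (⊥-elim)
open import Function.Base using (_∘_)
open import Function.Bundles using (_⇔_; mk⇔)
open import Relation.Nullary using (¬_; yes; no)
open import Relation.Nullary.Decidable using (¬?; decidable-stable)
open import Relation.Unary using (Decidable)
open import Relation.Binary.Definitions using (tri<; tri≈; tri>)
open import Relation.Binary.PropositionalEquality
  using (_≡_; _≢_; refl; sym; subst; subst₂) renaming (trans to ≡-trans)

private
  variable
    n : ℕ

-- The right-hand side is the membership bit computed by the local helper of `support`,
-- which cannot be named outside Defs.
lookup-support : ∀ (A : Multiset n) y → lookup (support A) y ≡ _
lookup-support A y = lookup∘tabulate _ y

∈-support⁺ : ∀ (A : Multiset n) {y} → 0 < A y → y ∈ support A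
∈-support⁺ A {y} 0<Ay = lookup⇒[]= y (support A) (lookup-inside 0<Ay)
  where
  lookup-inside : 0 < A y → lookup (support A) y ≡ inside
  lookup-inside rewrite lookup-support A y with A y
  ... | suc _ = λ _ → refl

∈-support⁻ : ∀ (A : Multiset n) {y} → y ∈ support A → 0 < A y
∈-support⁻ A {y} y∈A with A y | ≡-trans (sym ([]=⇒lookup y∈A)) (lookup-support A y)
... | suc _ | _ = s≤s z≤n

x∈p⇒⁅x⁆⊆p : ∀ {x} {p : Subset n} → x ∈ p → ⁅ x ⁆ ⊆ p
x∈p⇒⁅x⁆⊆p {x = x} {p} x∈p y∈⁅x⁆ = subst (_∈ p) (sym (x∈⁅y⁆⇒x≡y x y∈⁅x⁆)) x∈p

support-mono : ∀ {A B : Multiset n} → A ≤M B → support A ⊆ support B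
support-mono {A = A} {B} A≤B {y} y∈A = ∈-support⁺ B (<-≤-trans (∈-support⁻ A y∈A) (A≤B y))

indicator : Subset n → Multiset n
indicator S y = if lookup S y then 1 else 0

support-indicator : ∀ (S : Subset n) → support (indicator S) ≡ S
support-indicator S = ⊆-antisym (λ {y} → positive⇒∈ y ∘ ∈-support⁻ (indicator S))
                                (λ {y} → ∈-support⁺ (indicator S) ∘ ∈⇒positive y)
  where
  positive⇒∈ : ∀ y → 0 < indicator S y → y ∈ S
  positive⇒∈ y with lookup S y in eq
  ... | true = λ _ → lookup⇒[]= y S eq

  ∈⇒positive : ∀ y → y ∈ S → 0 < indicator S y
  ∈⇒positive y y∈S rewrite []=⇒lookup y∈S = s≤s z≤n

indicator-≤M : ∀ {S : Subset n} {A} → S ⊆ support A → indicator S ≤M A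
indicator-≤M {S = S} {A} S⊆A y with lookup S y in eq
... | true  = ∈-support⁻ A (S⊆A (lookup⇒[]= y S eq))
... | false = z≤n

support-downset : ∀ {F : Multiset n → Set} → IsDownset F → ∀ {A S} → F A → S ⊆ support A →
                  SubPoset.elem (SupportPoset n F) S
support-downset down {A} {S} FA S⊆A = indicator S , down (indicator S) A FA (indicator-≤M S⊆A) , support-indicator S

record OrderEmbedding (Q P : SubPoset) : Set where
  private
    module Q = SubPoset Q
    module P = SubPoset P
  field
    map        : Q.Carrier → P.Carrier
    map-elem   : ∀ {a} → Q.elem a → P.elem (map a)
    monotone   : ∀ {a b} → Q.elem a → Q.elem b → a Q.≤P b → map a P.≤P map b
    reflects-≤ : ∀ {a b} → Q.elem a → Q.elem b → map a P.≤P map b → a Q.≤P b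
    reflects-≈ : ∀ {a b} → Q.elem a → Q.elem b → map a P.≈P map b → a Q.≈P b

module _ {Q P : SubPoset} (f : OrderEmbedding Q P) where
  open OrderEmbedding f

  linearExtension-comap : ∀ {L} → IsLinearExtension P L →
                          IsLinearExtension Q (λ a b → L (map a) (map b))
  linearExtension-comap isL = record
    { reflexive = λ _ ea → L.reflexive _ (map-elem ea)
    ; antisym   = λ _ _ ea eb ab ba → reflects-≈ ea eb (L.antisym _ _ (map-elem ea) (map-elem eb) ab ba)
    ; trans     = λ _ _ _ ea eb ec → L.trans _ _ _ (map-elem ea) (map-elem eb) (map-elem ec)
    ; total     = λ _ _ ea eb → L.total _ _ (map-elem ea) (map-elem eb)
    ; extends   = λ _ _ ea eb a≤b → L.extends _ _ (map-elem ea) (map-elem eb) (monotone ea eb a≤b)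
    }
    where module L = IsLinearExtension isL

  realiser-comap : ∀ {k} → Realiser P k → Realiser Q k
  realiser-comap R = record
    { ext      = λ i a b → ext i (map a) (map b)
    ; isLinExt = λ i → linearExtension-comap (isLinExt i)
    ; realises = λ _ _ ea eb b≰a → realises _ _ (map-elem ea) (map-elem eb) (b≰a ∘ reflects-≤ eb ea)
    }
    where open Realiser R

indicator-embedding : ∀ {F : Multiset n → Set} → IsDownset F →
                      OrderEmbedding (SupportPoset n F) (MultisetPoset n F)
indicator-embedding {n = n} {F} down = record
  { map        = indicator
  ; map-elem   = λ { (A , FA , refl) → down _ A FA (indicator-≤M ⊆-refl) }
  ; monotone   = λ _ _ S⊆T → indicator-≤M (subst (_ ⊆_) (sym (support-indicator _)) S⊆T)
  ; reflects-≤ = λ _ _ → reflects-≤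
  ; reflects-≈ = λ _ _ S≈T → ⊆-antisym (reflects-≤ (≤-reflexive ∘ S≈T)) (reflects-≤ (≤-reflexive ∘ sym ∘ S≈T))
  }
  where
  reflects-≤ : ∀ {S T : Subset n} → indicator S ≤M indicator T → S ⊆ T
  reflects-≤ {S} {T} S≤T = subst₂ _⊆_ (support-indicator S) (support-indicator T) (support-mono S≤T)

Antichain : (Fin n → Set) → SubPoset
Antichain {n = n} P = record { Carrier = Fin n ; elem = P ; _≈P_ = _≡_ ; _≤P_ = _≡_ }

antichain-inclusion : ∀ {P Q : Fin n → Set} → (∀ {x} → P x → Q x) → OrderEmbedding (Antichain P) (Antichain Q)
antichain-inclusion P⊆Q = record
  { map = λ x → x ; map-elem = P⊆Q ; monotone = λ _ _ eq → eq ; reflects-≤ = λ _ _ eq → eq ; reflects-≈ = λ _ _ eq → eq }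

singleton-embedding : ∀ (F : Multiset n → Set) →
                      OrderEmbedding (Antichain (λ x → SubPoset.elem (SupportPoset n F) ⁅ x ⁆)) (SupportPoset n F)
singleton-embedding F = record
  { map        = ⁅_⁆
  ; map-elem   = λ e → e
  ; monotone   = λ { _ _ refl y∈ → y∈ }
  ; reflects-≤ = λ _ _ → reflects-≤
  ; reflects-≈ = λ _ _ → reflects-≤ ∘ ⊆-reflexive
  }
  where
  reflects-≤ : ∀ {x y} → ⁅ x ⁆ ⊆ ⁅ y ⁆ → x ≡ y
  reflects-≤ {x} {y} x⊆y = x∈⁅y⁆⇒x≡y y (x⊆y (x∈⁅x⁆ x))

module _ {P : Fin n → Set} {_≼_ : Fin n → Fin n → Set} (P? : Decidable P)
         (linear : IsLinearExtension (Antichain P) _≼_) where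
  open IsLinearExtension linear

  maximum-in : ∀ xs → (∀ {x} → x ∈ˡ xs → ¬ P x) ⊎ ∃ λ w → P w × ∀ {x} → x ∈ˡ xs → P x → x ≼ w
  maximum-in [] = inj₁ λ ()
  maximum-in (y ∷ ys) with P? y | maximum-in ys
  ... | no ¬Py | inj₁ none = inj₁ λ { (here refl) → ¬Py ; (there x∈) → none x∈ }
  ... | no ¬Py | inj₂ (w , Pw , max) = inj₂ (w , Pw , λ { (here refl) Py → ⊥-elim (¬Py Py) ; (there x∈) → max x∈ })
  ... | yes Py | inj₁ none = inj₂ (y , Py , λ { (here refl) _ → reflexive y Py ; (there x∈) Px → ⊥-elim (none x∈ Px) })
  ... | yes Py | inj₂ (w , Pw , max) with total y w Py Pw
  ...   | inj₁ y≼w = inj₂ (w , Pw , λ { (here refl) _ → y≼w ; (there x∈) → max x∈ })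
  ...   | inj₂ w≼y = inj₂ (y , Py , λ { (here refl) _ → reflexive y Py
                                        ; (there x∈) Px → trans _ w y Px Pw Py (max x∈ Px) w≼y })

  maximum : (∀ x → ¬ P x) ⊎ ∃ λ w → P w × ∀ {x} → P x → x ≼ w
  maximum with maximum-in (allFin n)
  ... | inj₁ none          = inj₁ λ x → none (∈-allFin x)
  ... | inj₂ (w , Pw , max) = inj₂ (w , Pw , max (∈-allFin _))

module MaxDifference {Active : Fin n → Set} {_≼_ : Fin n → Fin n → Set}
                     (linear : IsLinearExtension (Antichain Active) _≼_)
                     (F : Multiset n → Set)
                     (differences-active : ∀ {A B} → F A → F B → ∀ {y} → A y ≢ B y → Active y) where
  open IsLinearExtension linear

  Differ : Multiset n → Multiset n → Fin n → Set
  Differ A B y = A y ≢ B y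

  record DominantIncrease (A B : Multiset n) (w : Fin n) : Set where
    field
      increases : A w < B w
      dominates : ∀ {y} → Differ A B y → y ≼ w
  open DominantIncrease

  _⊑_ : Multiset n → Multiset n → Set
  A ⊑ B = A ≈M B ⊎ ∃ (DominantIncrease A B)

  differing-linear : ∀ {A B} → F A → F B → IsLinearExtension (Antichain (Differ A B)) _≼_
  differing-linear FA FB = linearExtension-comap (antichain-inclusion (differences-active FA FB)) linear

  maximal-difference : ∀ {A B} → F A → F B →
                       A ≈M B ⊎ ∃ λ w → Differ A B w × ∀ {y} → Differ A B y → y ≼ w
  maximal-difference {A} {B} FA FB with maximum (λ y → ¬? (A y ≟ B y)) (differing-linear FA FB)
  ... | inj₁ none = inj₁ λ y → decidable-stable (A y ≟ B y) (none y)
  ... | inj₂ max  = inj₂ max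

  increase-active : ∀ {A B w} → F A → F B → DominantIncrease A B w → Active w
  increase-active FA FB d = differences-active FA FB (<⇒≢ (increases d))

  DominantIncrease-resp : ∀ {A A′ B B′ w} → A ≈M A′ → B ≈M B′ →
                          DominantIncrease A B w → DominantIncrease A′ B′ w
  DominantIncrease-resp {w = w} A≈ B≈ d = record
    { increases = subst₂ _<_ (A≈ w) (B≈ w) (increases d)
    ; dominates = λ {y} A′≢B′ → dominates d λ A≡B → A′≢B′ (≡-trans (sym (A≈ y)) (≡-trans A≡B (B≈ y)))
    }

  ≤-beyond-increase : ∀ {A B x z} → F A → F B → DominantIncrease A B x → Active z → x ≼ z → A z ≤ B z
  ≤-beyond-increase {A} {B} {x} {z} FA FB d az x≼z with A z ≟ B z
  ... | yes Az≡Bz = ≤-reflexive Az≡Bz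
  ... | no  Az≢Bz = <⇒≤ (subst (λ v → A v < B v) (sym z≡x) (increases d))
    where
    z≡x : z ≡ x
    z≡x = antisym z x az (increase-active FA FB d) (dominates d Az≢Bz) x≼z

  dominates-composite : ∀ {A B C x z w} → F A → F B → F C →
                        DominantIncrease A B x → DominantIncrease B C z →
                        Active w → x ≼ w → z ≼ w → ∀ {y} → Differ A C y → y ≼ w
  dominates-composite {A} {B} {C} {x} {z} {w} FA FB FC dAB dBC aw x≼w z≼w {y} Ay≢Cy with A y ≟ B y
  ... | yes Ay≡By = trans y z w (differences-active FA FC Ay≢Cy) (increase-active FB FC dBC) aw
                          (dominates dBC λ By≡Cy → Ay≢Cy (≡-trans Ay≡By By≡Cy)) z≼w
  ... | no  Ay≢By = trans y x w (differences-active FA FC Ay≢Cy) (increase-active FA FB dAB) aw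
                          (dominates dAB Ay≢By) x≼w

  ⊑-antisym : ∀ A B → F A → F B → A ⊑ B → B ⊑ A → A ≈M B
  ⊑-antisym A B FA FB (inj₁ A≈B) _          = A≈B
  ⊑-antisym A B FA FB (inj₂ _)   (inj₁ B≈A) = sym ∘ B≈A
  ⊑-antisym A B FA FB (inj₂ (w , dAB)) (inj₂ (v , dBA)) =
    ⊥-elim (<-asym (increases dAB) (subst (λ u → B u < A u) v≡w (increases dBA)))
    where
    v≡w : v ≡ w
    v≡w = antisym v w (increase-active FB FA dBA) (increase-active FA FB dAB)
                  (dominates dAB (>⇒≢ (increases dBA))) (dominates dBA (>⇒≢ (increases dAB)))

  ⊑-trans : ∀ A B C → F A → F B → F C → A ⊑ B → B ⊑ C → A ⊑ C
  ⊑-trans A B C FA FB FC (inj₁ A≈B) (inj₁ B≈C) = inj₁ λ y → ≡-trans (A≈B y) (B≈C y)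
  ⊑-trans A B C FA FB FC (inj₁ A≈B) (inj₂ (w , d)) = inj₂ (w , DominantIncrease-resp (sym ∘ A≈B) (λ _ → refl) d)
  ⊑-trans A B C FA FB FC (inj₂ (w , d)) (inj₁ B≈C) = inj₂ (w , DominantIncrease-resp (λ _ → refl) B≈C d)
  ⊑-trans A B C FA FB FC (inj₂ (x , dAB)) (inj₂ (z , dBC)) = inj₂ (compose (total x z ax az))
    where
    ax : Active x
    ax = increase-active FA FB dAB
    az : Active z
    az = increase-active FB FC dBC

    compose : x ≼ z ⊎ z ≼ x → ∃ (DominantIncrease A C)
    compose (inj₁ x≼z) = z , record
      { increases = ≤-<-trans (≤-beyond-increase FA FB dAB az x≼z) (increases dBC)
      ; dominates = dominates-composite FA FB FC dAB dBC az x≼z (reflexive z az)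
      }
    compose (inj₂ z≼x) = x , record
      { increases = <-≤-trans (increases dAB) (≤-beyond-increase FB FC dBC ax z≼x)
      ; dominates = dominates-composite FA FB FC dAB dBC ax (reflexive x ax) z≼x
      }

  ⊑-total : ∀ A B → F A → F B → A ⊑ B ⊎ B ⊑ A
  ⊑-total A B FA FB with maximal-difference FA FB
  ... | inj₁ A≈B = inj₁ (inj₁ A≈B)
  ... | inj₂ (w , Aw≢Bw , max) with <-cmp (A w) (B w)
  ...   | tri< Aw<Bw _ _ = inj₁ (inj₂ (w , record { increases = Aw<Bw ; dominates = max }))
  ...   | tri≈ _ Aw≡Bw _ = ⊥-elim (Aw≢Bw Aw≡Bw)
  ...   | tri> _ _ Bw<Aw = inj₂ (inj₂ (w , record { increases = Bw<Aw ; dominates = λ B≢A → max (B≢A ∘ sym) }))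

  ⊑-extends : ∀ A B → F A → F B → A ≤M B → A ⊑ B
  ⊑-extends A B FA FB A≤B with maximal-difference FA FB
  ... | inj₁ A≈B                = inj₁ A≈B
  ... | inj₂ (w , Aw≢Bw , max) = inj₂ (w , record { increases = ≤∧≢⇒< (A≤B w) Aw≢Bw ; dominates = max })

  ⊑-isLinearExtension : IsLinearExtension (MultisetPoset n F) _⊑_
  ⊑-isLinearExtension = record
    { reflexive = λ _ _ → inj₁ λ _ → refl
    ; antisym   = ⊑-antisym
    ; trans     = ⊑-trans
    ; total     = ⊑-total
    ; extends   = ⊑-extends
    }

  ⊑-from-increase : ∀ {A B x} → F A → F B → A x < B x → (∀ {w} → B w < A w → w ≼ x) → A ⊑ B
  ⊑-from-increase {A} {B} {x} FA FB Ax<Bx decreases-below with ⊑-total A B FA FB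
  ... | inj₁ A⊑B               = A⊑B
  ... | inj₂ (inj₁ B≈A)        = ⊥-elim (<⇒≢ Ax<Bx (sym (B≈A x)))
  ... | inj₂ (inj₂ (w , dBA)) = ⊥-elim (<-asym Ax<Bx (subst (λ u → B u < A u) w≡x (increases dBA)))
    where
    w≡x : w ≡ x
    w≡x = antisym w x (increase-active FB FA dBA) (differences-active FA FB (<⇒≢ Ax<Bx))
                  (decreases-below (increases dBA)) (dominates dBA (>⇒≢ Ax<Bx))

module _ {F : Multiset n → Set} (down : IsDownset F) {k} (R : Realiser (SupportPoset n F) k) where
  open Realiser R

  Active : Fin n → Set
  Active x = SubPoset.elem (SupportPoset n F) ⁅ x ⁆

  positive⇒active : ∀ {A x} → F A → 0 < A x → Active x
  positive⇒active {A} FA 0<Ax = support-downset down FA (x∈p⇒⁅x⁆⊆p (∈-support⁺ A 0<Ax))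

  differences-active : ∀ {A B} → F A → F B → ∀ {y} → A y ≢ B y → Active y
  differences-active {A} {B} FA FB {y} Ay≢By with A y in eq
  ... | suc _ = positive⇒active FA (subst (0 <_) (sym eq) (s≤s z≤n))
  ... | zero  = positive⇒active FB (≤∧≢⇒< z≤n Ay≢By)

  module Lex (i : Fin k) =
    MaxDifference (linearExtension-comap (singleton-embedding F) (isLinExt i)) F differences-active

  lexicographic-realiser : Realiser (MultisetPoset n F) k
  lexicographic-realiser = record
    { ext      = Lex._⊑_
    ; isLinExt = Lex.⊑-isLinearExtension
    ; realises = λ A B FA FB B≰A →
        let x , Bx≰Ax = ¬∀⟶∃¬ n (λ y → B y ≤ A y) (λ y → B y ≤? A y) B≰A
        in  realises-at FA FB (≰⇒> Bx≰Ax)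
    }
    where
    realises-at : ∀ {A B x} → F A → F B → A x < B x → ∃ λ i → Lex._⊑_ i A B
    realises-at {A} {B} {x} FA FB Ax<Bx = i , Lex.⊑-from-increase i FA FB Ax<Bx below-x
      where
      T : Subset n
      T = support A ∩ ∁ ⁅ x ⁆

      T-elem : SubPoset.elem (SupportPoset n F) T
      T-elem = support-downset down FA (p∩q⊆p (support A) (∁ ⁅ x ⁆))

      separation : ∃ λ i → ext i T ⁅ x ⁆
      separation = realises T ⁅ x ⁆ T-elem (differences-active FA FB (<⇒≢ Ax<Bx))
                            (λ x⊆T → x∈∁p⇒x∉p (proj₂ (x∈p∩q⁻ _ _ (x⊆T (x∈⁅x⁆ x)))) (x∈⁅x⁆ x))

      i : Fin k
      i = proj₁ separation

      below-x : ∀ {w} → B w < A w → ext i ⁅ w ⁆ ⁅ x ⁆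
      below-x {w} Bw<Aw = L.trans _ _ _ aw T-elem (differences-active FA FB (<⇒≢ Ax<Bx))
                                  (L.extends _ _ aw T-elem (x∈p⇒⁅x⁆⊆p w∈T)) (proj₂ separation)
        where
        module L = IsLinearExtension (isLinExt i)
        aw : Active w
        aw = differences-active FA FB (>⇒≢ Bw<Aw)
        w∈T : w ∈ T
        w∈T = x∈p∩q⁺ (∈-support⁺ A (≤-<-trans z≤n Bw<Aw) , x∉p⇒x∈∁p (x≢y⇒x∉⁅y⁆ λ { refl → <-asym Ax<Bx Bw<Aw }))

corollary3p2 : (n : ℕ) (F : Multiset n → Set) → IsDownset F →
    (k : ℕ) → DimAtMost (MultisetPoset n F) k ⇔ DimAtMost (SupportPoset n F) k
corollary3p2 n F down k = mk⇔ (realiser-comap (indicator-embedding down)) (lexicographic-realiser down)
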